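{- Let $G$ be a connected graph of order $n$ with diameter $\mathrm{diam}(G)$, and let $g$ be an integer with $0\leq g\leq \left\lfloor\frac{\mathrm{diam}(G)}{2}\right\rfloor-1$. Then $G$ has an $R_g$-cutset and $$\kappa_g(G)\leq n-\mathrm{diam}(G).$$ Moreover, the bound is sharp: for the path $P_n$ ($n\ge 3$) and every such $g$, $\kappa_g(P_n)=n-\mathrm{diam}(P_n)=1$.
   Context: A set $S$ of vertices is a cutset if $G-S$ is disconnected; for a non-negative integer $g$, a cutset is an $R_g$-cutset if every component of $G-S$ has at least $g+1$ vertices. If $G$ has an $R_g$-cutset, $\kappa_g(G)$ is the minimum cardinality of an $R_g$-cutset of $G$. $\mathrm{diam}(G)$ is the maximum distance between two vertices of $G$. -}

module Defs where

open import Level using (0ℓ)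
open import Data.Nat using (ℕ; zero; suc; _≤_)
open import Data.Fin using (Fin; toℕ)
open import Data.Fin.Subset using (Subset; _∈_; _∉_; ∣_∣)
open import Data.List using (List; length)
open import Data.List.Relation.Unary.All using (All)
open import Data.List.Relation.Unary.Unique.Propositional using (Unique)
open import Data.Product using (Σ; _×_; ∃; ∃-syntax)
open import Data.Sum using (_⊎_)
open import Data.Unit using (⊤)
open import Relation.Nullary using (¬_)
open import Relation.Binary.PropositionalEquality using (_≡_)

record Graph (n : ℕ) : Set₁ where
  field
    Adj     : Fin n → Fin n → Set
    adj-sym : ∀ {u v} → Adj u v → Adj v u
    adj-irr : ∀ {u} → ¬ Adj u u
open Graph public

data WalkIn {n : ℕ} (G : Graph n) (P : Fin n → Set) : Fin n → Fin n → ℕ → Set where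
  here : ∀ {u} → P u → WalkIn G P u u zero
  step : ∀ {u w v k} → P u → Adj G u w → WalkIn G P w v k → WalkIn G P u v (suc k)

Walk : ∀ {n} → Graph n → Fin n → Fin n → ℕ → Set
Walk G = WalkIn G (λ _ → ⊤)

Connected : ∀ {n} → Graph n → Set
Connected G = ∀ u v → ∃[ k ] Walk G u v k

Dist : ∀ {n} → Graph n → Fin n → Fin n → ℕ → Set
Dist G u v k = Walk G u v k × (∀ m → Walk G u v m → k ≤ m)

IsDiam : ∀ {n} → Graph n → ℕ → Set
IsDiam G D = (∃[ u ] ∃[ v ] Dist G u v D) × (∀ u v k → Dist G u v k → k ≤ D)

ReachOut : ∀ {n} → Graph n → Subset n → Fin n → Fin n → Set
ReachOut G S u v = ∃[ k ] WalkIn G (λ x → x ∉ S) u v k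

IsCutset : ∀ {n} → Graph n → Subset n → Set
IsCutset G S = ∃[ u ] ∃[ v ] (u ∉ S × v ∉ S × ¬ ReachOut G S u v)

-- S is an R_g-cutset: a cutset such that every component of G - S has
-- at least g+1 vertices (the component of each vertex v of G - S contains
-- g+1 distinct vertices).
IsRgCutset : {n : ℕ} → Graph n → ℕ → Subset n → Set
IsRgCutset {n} G g S =
  IsCutset G S ×
  (∀ v → v ∉ S → Σ (List (Fin n)) λ xs →
      length xs ≡ suc g × Unique xs × All (ReachOut G S v) xs)

IsKappa : ∀ {n} → Graph n → ℕ → ℕ → Set
IsKappa G g k =
  (Σ (Subset _) λ S → IsRgCutset G g S × ∣ S ∣ ≡ k) ×
  (∀ S → IsRgCutset G g S → k ≤ ∣ S ∣)

PathGraph : (n : ℕ) → Graph n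
PathGraph n = record
  { Adj = λ i j → (toℕ j ≡ suc (toℕ i)) ⊎ (toℕ i ≡ suc (toℕ j))
  ; adj-sym = symP
  ; adj-irr = irr
  }
  where
  open import Data.Sum using (inj₁; inj₂)
  open import Data.Nat.Properties using (1+n≢n)
  open import Relation.Binary.PropositionalEquality using (sym)
  symP : ∀ {i j : Fin n} → (toℕ j ≡ suc (toℕ i)) ⊎ (toℕ i ≡ suc (toℕ j))
       → (toℕ i ≡ suc (toℕ j)) ⊎ (toℕ j ≡ suc (toℕ i))
  symP (inj₁ p) = inj₂ p
  symP (inj₂ p) = inj₁ p
  irr : ∀ {i : Fin n} → ¬ ((toℕ i ≡ suc (toℕ i)) ⊎ (toℕ i ≡ suc (toℕ i)))
  irr (inj₁ p) = 1+n≢n (sym p)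
  irr (inj₂ p) = 1+n≢n (sym p)

-- Let x₀ x₁ … x_D be a shortest path between two vertices at distance D = diam(G).
-- Keep the D vertices of this path other than x_{g+1} and delete everything else:
-- the deleted set S has n − D vertices.  Since subpaths of a shortest path are
-- shortest, x₀ … x_g and x_{g+2} … x_D are joined by no edge and consist of
-- distinct vertices, so G − S splits into these two paths, of g + 1 and
-- D − g − 1 ≥ g + 1 vertices.  For the path Pₙ we have D = n − 1, and every
-- cutset of a connected graph is nonempty, so κ_g(Pₙ) = 1.
module Submission where

open import Defs
open import Function using (_∘_)
open import Data.Nat using (ℕ; zero; suc; _≤_; _<_; _∸_; _+_; _*_; z≤n; s≤s)
open import Data.Nat.Properties
open import Data.Nat.DivMod using (_/_; _mod_; m/n*n≤m; m<n⇒m%n≡m)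
open import Data.Fin using (Fin; toℕ)
open import Data.Fin.Properties using (toℕ<n; toℕ-fromℕ<; toℕ-injective)
open import Data.Fin.Subset using (Subset; ∣_∣; ⁅_⁆; _∪_; ∁; _-_; _∈_; _∉_) renaming (⊥ to ∅)
open import Data.Fin.Subset.Properties
  using (∉⊥; x∈⁅x⁆; x∈⁅y⁆⇒x≡y; x∈p∪q⁻; x∈p∪q⁺; x∈p⇒x∉∁p; x∉∁p⇒x∈p; ∣∁p∣≡n∸∣p∣; x∈p∧x≢y⇒x∈p-y; x∈p⇒∣p-x∣<∣p∣)
open import Data.List using (List; []; _∷_; length; _++_; foldr; applyUpTo)
open import Data.List.Properties using (length-++; length-applyUpTo)
open import Data.List.Membership.Propositional using () renaming (_∈_ to _∈ˡ_)
open import Data.List.Membership.Propositional.Properties using (∈-++⁺ˡ; ∈-++⁺ʳ; ∈-++⁻; ∈-applyUpTo⁺; ∈-applyUpTo⁻)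
open import Data.List.Relation.Unary.Any using (here; there)
open import Data.List.Relation.Unary.All as All using (All; []; _∷_)
open import Data.List.Relation.Unary.AllPairs using ([]; _∷_)
open import Data.List.Relation.Unary.Unique.Propositional using (Unique)
import Data.List.Relation.Unary.Unique.Propositional.Properties as Unique
open import Data.Product using (Σ; _×_; _,_; proj₁; proj₂; ∃-syntax)
open import Data.Sum using (_⊎_; inj₁; inj₂)
open import Data.Unit using (tt)
open import Data.Empty using (⊥-elim)
open import Relation.Nullary using (¬_)
open import Relation.Binary.PropositionalEquality using (_≡_; _≢_; refl; sym; trans; cong; cong₂; subst; subst₂; module ≡-Reasoning)

module _ {n : ℕ} {G : Graph n} where

  module _ {P : Fin n → Set} where

    source : ∀ {u v k} → WalkIn G P u v k → P u
    source (here p)     = p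
    source (step p _ _) = p

    snoc : ∀ {u v w k} → WalkIn G P u v k → Adj G v w → P w → WalkIn G P u w (suc k)
    snoc (here p)        b q = step p b (here q)
    snoc (step p a walk) b q = step p a (snoc walk b q)

    reverse : ∀ {u v k} → WalkIn G P u v k → WalkIn G P v u k
    reverse (here p)        = here p
    reverse (step p a walk) = snoc (reverse walk) (adj-sym G a) p

    _++ʷ_ : ∀ {u v w k l} → WalkIn G P u v k → WalkIn G P v w l → WalkIn G P u w (k + l)
    here _        ++ʷ walk′ = walk′
    step p a walk ++ʷ walk′ = step p a (walk ++ʷ walk′)

    transport : {Q : Fin n → Set} → (∀ {x y} → Q x → Adj G x y → P y → Q y) →
                ∀ {u v k} → WalkIn G P u v k → Q u → Q v
    transport closed (here _)        q = q
    transport closed (step _ a walk) q = transport closed walk (closed q a (source walk))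

    vertex : ∀ {u v k} → WalkIn G P u v k → ℕ → Fin n
    vertex {u = u} (here _)        _       = u
    vertex {u = u} (step _ _ _)    zero    = u
    vertex         (step _ _ walk) (suc i) = vertex walk i

    vertex-zero : ∀ {u v k} (walk : WalkIn G P u v k) → vertex walk 0 ≡ u
    vertex-zero (here _)     = refl
    vertex-zero (step _ _ _) = refl

    vertex-last : ∀ {u v k} (walk : WalkIn G P u v k) → vertex walk k ≡ v
    vertex-last (here _)        = refl
    vertex-last (step _ _ walk) = vertex-last walk

    vertex-adjacent : ∀ {u v k} (walk : WalkIn G P u v k) →
                      ∀ {i} → i < k → Adj G (vertex walk i) (vertex walk (suc i))
    vertex-adjacent (step _ a walk) {zero}  _         = subst (Adj G _) (sym (vertex-zero walk)) a
    vertex-adjacent (step _ _ walk) {suc i} (s≤s i<k) = vertex-adjacent walk i<k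

  map : ∀ {P Q : Fin n → Set} → (∀ {x} → P x → Q x) → ∀ {u v k} → WalkIn G P u v k → WalkIn G Q u v k
  map f (here p)        = here (f p)
  map f (step p a walk) = step (f p) a (map f walk)

  cutset-nonempty : Connected G → ∀ {S} → IsCutset G S → 0 < ∣ S ∣
  cutset-nonempty connected {S} (u , v , _ , _ , separated) = n≢0⇒n>0 λ ∣S∣≡0 →
    let k , walk = connected u v in separated (k , map (λ _ → outside ∣S∣≡0) walk)
    where
    outside : ∣ S ∣ ≡ 0 → ∀ {x} → x ∉ S
    outside ∣S∣≡0 x∈S = n≮0 (subst (∣ S - _ ∣ <_) ∣S∣≡0 (x∈p⇒∣p-x∣<∣p∣ x∈S))

module Trail {n : ℕ} (G : Graph n) (f : ℕ → Fin n) (D : ℕ)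
             (adjacent : ∀ {i} → i < D → Adj G (f i) (f (suc i))) where

  Within : (Fin n → Set) → ℕ → ℕ → Set
  Within P lo hi = ∀ {k} → lo ≤ k → k ≤ hi → P (f k)

  Within-narrow : ∀ {P lo hi i j} → Within P lo hi → lo ≤ i → j ≤ hi → Within P i j
  Within-narrow inside lo≤i j≤hi i≤k k≤j = inside (≤-trans lo≤i i≤k) (≤-trans k≤j j≤hi)

  ascending : ∀ {P i j} → i ≤ j → j ≤ D → Within P i j → WalkIn G P (f i) (f j) (j ∸ i)
  ascending {i = i} {j} i≤j = ascend (j ∸ i) (m∸n+n≡m i≤j)
    where
    ascend : ∀ {P} m {i j} → m + i ≡ j → j ≤ D → Within P i j → WalkIn G P (f i) (f j) m
    ascend zero    refl _   inside = here (inside ≤-refl ≤-refl)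
    ascend (suc m) {i} refl j≤D inside =
      snoc (ascend m refl (<⇒≤ j≤D) (λ i≤k k≤j → inside i≤k (m≤n⇒m≤1+n k≤j)))
           (adjacent j≤D) (inside (m≤n+m i (suc m)) ≤-refl)

  walk-within : ∀ {P lo hi} → hi ≤ D → Within P lo hi →
                ∀ {i j} → lo ≤ i → i ≤ hi → lo ≤ j → j ≤ hi →
                ∃[ k ] k ≤ hi ∸ lo × WalkIn G P (f i) (f j) k
  walk-within {P} hi≤D inside {i} {j} lo≤i i≤hi lo≤j j≤hi with ≤-total i j
  ... | inj₁ i≤j = j ∸ i , ∸-mono j≤hi lo≤i ,
                   ascending i≤j (≤-trans j≤hi hi≤D) (Within-narrow {P} inside lo≤i j≤hi)
  ... | inj₂ j≤i = i ∸ j , ∸-mono i≤hi lo≤j ,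
                   reverse (ascending j≤i (≤-trans i≤hi hi≤D) (Within-narrow {P} inside lo≤j i≤hi))

module _ {n : ℕ} where

  fromList : List (Fin n) → Subset n
  fromList = foldr (λ x p → ⁅ x ⁆ ∪ p) ∅

  ∈-fromList⁻ : ∀ {x} xs → x ∈ fromList xs → x ∈ˡ xs
  ∈-fromList⁻ []       x∈ = ⊥-elim (∉⊥ x∈)
  ∈-fromList⁻ (y ∷ xs) x∈ with x∈p∪q⁻ ⁅ y ⁆ (fromList xs) x∈
  ... | inj₁ x∈⁅y⁆ = here (x∈⁅y⁆⇒x≡y y x∈⁅y⁆)
  ... | inj₂ x∈xs  = there (∈-fromList⁻ xs x∈xs)

  ∈-fromList⁺ : ∀ {x xs} → x ∈ˡ xs → x ∈ fromList xs
  ∈-fromList⁺ (here refl) = x∈p∪q⁺ (inj₁ (x∈⁅x⁆ _))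
  ∈-fromList⁺ (there x∈)  = x∈p∪q⁺ (inj₂ (∈-fromList⁺ x∈))

  length≤∣∣ : ∀ {p : Subset n} {xs} → Unique xs → All (_∈ p) xs → length xs ≤ ∣ p ∣
  length≤∣∣ []                 []            = z≤n
  length≤∣∣ {p} (x∉xs ∷ unique) (x∈p ∷ xs⊆p) =
    ≤-<-trans (length≤∣∣ unique (All.zipWith in-p-x (x∉xs , xs⊆p))) (x∈p⇒∣p-x∣<∣p∣ x∈p)
    where
    in-p-x : ∀ {x y} → x ≢ y × y ∈ p → y ∈ p - x
    in-p-x (x≢y , y∈p) = x∈p∧x≢y⇒x∈p-y y∈p (x≢y ∘ sym)

module Geodesic {n : ℕ} {G : Graph n} {u v : Fin n} {D : ℕ} (geodesic : Dist G u v D) where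

  x : ℕ → Fin n
  x = vertex (proj₁ geodesic)

  open Trail G x D (vertex-adjacent (proj₁ geodesic)) public

  shortest : ∀ {k} → Walk G (x 0) (x D) k → D ≤ k
  shortest walk = proj₂ geodesic _
    (subst₂ (λ a b → Walk G a b _) (vertex-zero (proj₁ geodesic)) (vertex-last (proj₁ geodesic)) walk)

  -- Splicing the walk between the prefix x₀…x_i and the suffix x_j…x_D.
  geodesic-lower : ∀ {i j k} → i ≤ D → j ≤ D → Walk G (x i) (x j) k → j ≤ i + k
  geodesic-lower {i} {j} {k} i≤D j≤D walk = +-cancelʳ-≤ (D ∸ j) j (i + k) (begin
    j + (D ∸ j)       ≡⟨ m+[n∸m]≡n j≤D ⟩
    D                 ≤⟨ shortest (prefix ++ʷ (walk ++ʷ suffix)) ⟩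
    i + (k + (D ∸ j)) ≡⟨ +-assoc i k (D ∸ j) ⟨
    i + k + (D ∸ j)   ∎)
    where
    open ≤-Reasoning
    prefix : Walk G (x 0) (x i) i
    prefix = ascending z≤n i≤D (λ _ _ → tt)
    suffix : Walk G (x j) (x D) (D ∸ j)
    suffix = ascending j≤D ≤-refl (λ _ _ → tt)

  geodesic-injective : ∀ {i j} → i ≤ D → j ≤ D → x i ≡ x j → i ≡ j
  geodesic-injective i≤D j≤D xi≡xj = ≤-antisym (below j≤D i≤D (sym xi≡xj)) (below i≤D j≤D xi≡xj)
    where
    below : ∀ {i j} → i ≤ D → j ≤ D → x i ≡ x j → j ≤ i
    below {i} i≤D j≤D xi≡xj = subst (_ ≤_) (+-identityʳ i)
      (geodesic-lower i≤D j≤D (subst (λ y → Walk G (x i) y 0) xi≡xj (here tt)))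

  geodesic-chordless : ∀ {i j} → i ≤ D → j ≤ D → Adj G (x i) (x j) → j ≤ suc i
  geodesic-chordless {i} {j} i≤D j≤D xi~xj =
    subst (j ≤_) (+-comm i 1) (geodesic-lower i≤D j≤D (step tt xi~xj (here tt)))

  segment : ℕ → ℕ → List (Fin n)
  segment lo len = applyUpTo (λ i → x (lo + i)) len

  length-segment : ∀ lo len → length (segment lo len) ≡ len
  length-segment lo = length-applyUpTo (λ i → x (lo + i))

  ∈-segment⁺ : ∀ {lo len j} → lo ≤ j → j < lo + len → x j ∈ˡ segment lo len
  ∈-segment⁺ {lo} {len} lo≤j j<lo+len = subst (λ k → x k ∈ˡ segment lo len) (m+[n∸m]≡n lo≤j)
    (∈-applyUpTo⁺ _ (+-cancelˡ-< lo _ len (subst (_< lo + len) (sym (m+[n∸m]≡n lo≤j)) j<lo+len)))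

  ∈-segment⁻ : ∀ {lo len y} → y ∈ˡ segment lo len → ∃[ j ] (lo ≤ j × j < lo + len) × x j ≡ y
  ∈-segment⁻ {lo} y∈ with i , i<len , refl ← ∈-applyUpTo⁻ _ y∈ =
    lo + i , (m≤m+n lo i , +-monoʳ-< lo i<len) , refl

  segment-unique : ∀ {lo len} → lo + len ≤ suc D → Unique (segment lo len)
  segment-unique {lo} {len} end≤ = Unique.applyUpTo⁺₁ _ _ λ i<i′ i′<len eq →
    <⇒≢ (+-monoʳ-< lo i<i′)
        (geodesic-injective (in-range (<-trans i<i′ i′<len)) (in-range i′<len) eq)
    where
    in-range : ∀ {i} → i < len → lo + i ≤ D
    in-range i<len = ≤-pred (≤-trans (+-monoʳ-< lo i<len) end≤)

module GeodesicCut {n : ℕ} {G : Graph n} {u v : Fin n} {D : ℕ} (geodesic : Dist G u v D)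
                   (g : ℕ) (room : suc g + suc g ≤ D) where

  open Geodesic geodesic

  Left Right Kept : ℕ → Set
  Left j  = j ≤ g
  Right j = suc (suc g) ≤ j × j ≤ D
  Kept j  = Left j ⊎ Right j

  kept : List (Fin n)
  kept = segment 0 (suc g) ++ segment (suc (suc g)) (D ∸ suc g)

  S : Subset n
  S = ∁ (fromList kept)

  g<D : g < D
  g<D = m+n≤o⇒m≤o (suc g) room

  g+2≤D : suc (suc g) ≤ D
  g+2≤D = ≤-trans (s≤s (m≤n+m (suc g) g)) room

  right-end : suc (suc g) + (D ∸ suc g) ≡ suc D
  right-end = cong suc (m+[n∸m]≡n g<D)

  Kept⇒∉S : ∀ {j} → Kept j → x j ∉ S
  Kept⇒∉S = x∈p⇒x∉∁p ∘ ∈-fromList⁺ ∘ ∈kept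
    where
    ∈kept : ∀ {j} → Kept j → x j ∈ˡ kept
    ∈kept     (inj₁ j≤g)           = ∈-++⁺ˡ (∈-segment⁺ z≤n (s≤s j≤g))
    ∈kept {j} (inj₂ (g+2≤j , j≤D)) =
      ∈-++⁺ʳ _ (∈-segment⁺ g+2≤j (subst (j <_) (sym right-end) (s≤s j≤D)))

  ∉S⇒Kept : ∀ {y} → y ∉ S → ∃[ j ] Kept j × x j ≡ y
  ∉S⇒Kept y∉S with ∈-++⁻ (segment 0 (suc g)) (∈-fromList⁻ kept (x∉∁p⇒x∈p y∉S))
  ... | inj₁ y∈left with j , (_ , s≤s j≤g) , xj≡y ← ∈-segment⁻ y∈left = j , inj₁ j≤g , xj≡y
  ... | inj₂ y∈right with j , (g+2≤j , j<end) , xj≡y ← ∈-segment⁻ y∈right =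
    j , inj₂ (g+2≤j , ≤-pred (subst (j <_) right-end j<end)) , xj≡y

  InLeft : Fin n → Set
  InLeft y = ∃[ j ] Left j × x j ≡ y

  InLeft-closed : ∀ {y z k} → WalkIn G (_∉ S) y z k → InLeft y → InLeft z
  InLeft-closed = transport edge
    where
    edge : ∀ {y z} → InLeft y → Adj G y z → z ∉ S → InLeft z
    edge (i , i≤g , refl) xi~z z∉S with ∉S⇒Kept z∉S
    ... | j , inj₁ j≤g , xj≡z = j , j≤g , xj≡z
    ... | j , inj₂ (g+2≤j , j≤D) , refl =
      ⊥-elim (1+n≰n (≤-trans g+2≤j (≤-trans (geodesic-chordless i≤D j≤D xi~z) (s≤s i≤g))))
      where
      i≤D : i ≤ D
      i≤D = ≤-trans i≤g (<⇒≤ g<D)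

  separated : ¬ ReachOut G S (x 0) (x D)
  separated (_ , walk) with j , j≤g , xj≡xD ← InLeft-closed walk (0 , z≤n , refl) =
    <⇒≱ g<D (subst (_≤ g) (geodesic-injective (≤-trans j≤g (<⇒≤ g<D)) ≤-refl xj≡xD) j≤g)

  block-reaches : ∀ {lo hi} → hi ≤ D → Within (_∉ S) lo hi →
                  ∀ {j} → lo ≤ j → j ≤ hi → ∀ {len} → lo + len ≤ suc hi →
                  All (ReachOut G S (x j)) (segment lo len)
  block-reaches hi≤D inside lo≤j j≤hi end≤ = All.tabulate reaches
    where
    reaches : ∀ {y} → y ∈ˡ segment _ _ → ReachOut G S (x _) y
    reaches y∈ with i , (lo≤i , i<end) , refl ← ∈-segment⁻ y∈
               with k , _ , walk ← walk-within hi≤D inside lo≤j j≤hi lo≤i (≤-pred (≤-trans i<end end≤)) =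
      k , walk

  component : ∀ {y} → y ∉ S → Σ (List (Fin n)) λ ys →
              length ys ≡ suc g × Unique ys × All (ReachOut G S y) ys
  component y∉S with ∉S⇒Kept y∉S
  ... | j , inj₁ j≤g , refl =
    segment 0 (suc g) , length-segment 0 (suc g) , segment-unique (s≤s (<⇒≤ g<D)) ,
    block-reaches (<⇒≤ g<D) (λ _ k≤g → Kept⇒∉S (inj₁ k≤g)) z≤n j≤g ≤-refl
  ... | j , inj₂ (g+2≤j , j≤D) , refl =
    segment (suc (suc g)) (suc g) , length-segment (suc (suc g)) (suc g) , segment-unique (s≤s room) ,
    block-reaches ≤-refl (λ g+2≤k k≤D → Kept⇒∉S (inj₂ (g+2≤k , k≤D))) g+2≤j j≤D (s≤s room)

  kept-unique : Unique kept
  kept-unique =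
    Unique.++⁺ (segment-unique (s≤s (<⇒≤ g<D))) (segment-unique (≤-reflexive right-end)) disjoint
    where
    disjoint : ∀ {y} → ¬ (y ∈ˡ segment 0 (suc g) × y ∈ˡ segment (suc (suc g)) (D ∸ suc g))
    disjoint (y∈left , y∈right)
      with i , (_ , s≤s i≤g) , xi≡y ← ∈-segment⁻ y∈left
      with j , (g+2≤j , j<end) , xj≡y ← ∈-segment⁻ y∈right =
      1+n≰n (≤-trans g+2≤j (subst (_≤ suc g) i≡j (m≤n⇒m≤1+n i≤g)))
      where
      i≡j : i ≡ j
      i≡j = geodesic-injective (≤-trans i≤g (<⇒≤ g<D)) (≤-pred (subst (j <_) right-end j<end))
                               (trans xi≡y (sym xj≡y))

  length-kept : length kept ≡ D
  length-kept = begin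
    length kept
      ≡⟨ length-++ (segment 0 (suc g)) ⟩
    length (segment 0 (suc g)) + length (segment (suc (suc g)) (D ∸ suc g))
      ≡⟨ cong₂ _+_ (length-segment 0 (suc g)) (length-segment (suc (suc g)) (D ∸ suc g)) ⟩
    suc g + (D ∸ suc g)
      ≡⟨ m+[n∸m]≡n g<D ⟩
    D ∎
    where open ≡-Reasoning

  ∣S∣≤n∸D : ∣ S ∣ ≤ n ∸ D
  ∣S∣≤n∸D = begin
    ∣ S ∣                 ≡⟨ ∣∁p∣≡n∸∣p∣ (fromList kept) ⟩
    n ∸ ∣ fromList kept ∣ ≤⟨ ∸-monoʳ-≤ n (length≤∣∣ kept-unique (All.tabulate ∈-fromList⁺)) ⟩
    n ∸ length kept       ≡⟨ cong (n ∸_) length-kept ⟩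
    n ∸ D                 ∎
    where open ≤-Reasoning

  Rg-cutset : Σ (Subset n) λ S → IsRgCutset G g S × ∣ S ∣ ≤ n ∸ D
  Rg-cutset = S , ((x 0 , x D , Kept⇒∉S (inj₁ z≤n) , Kept⇒∉S (inj₂ (g+2≤D , ≤-refl)) , separated) ,
                   λ _ → component) , ∣S∣≤n∸D

path-walk-length : ∀ {n P} {u v : Fin n} {k} → WalkIn (PathGraph n) P u v k → toℕ v ≤ toℕ u + k
path-walk-length {u = u} (here _) = m≤m+n (toℕ u) 0
path-walk-length {u = u} (step {w = w} {k = k} _ u~w walk) = begin
  toℕ _           ≤⟨ path-walk-length walk ⟩
  toℕ w + k       ≤⟨ +-monoˡ-≤ k (neighbour-bound u~w) ⟩
  suc (toℕ u) + k ≡⟨ +-suc (toℕ u) k ⟨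
  toℕ u + suc k   ∎
  where
  open ≤-Reasoning
  neighbour-bound : ∀ {w} → Adj (PathGraph _) u w → toℕ w ≤ suc (toℕ u)
  neighbour-bound (inj₁ w≡u+1) = ≤-reflexive w≡u+1
  neighbour-bound (inj₂ u≡w+1) = ≤-trans (n≤1+n _) (≤-trans (≤-reflexive (sym u≡w+1)) (n≤1+n _))

module PathGraphProperties (m : ℕ) where

  position : ℕ → Fin (suc m)
  position i = i mod suc m

  toℕ-position : ∀ {i} → i ≤ m → toℕ (position i) ≡ i
  toℕ-position i≤m = trans (toℕ-fromℕ< _) (m<n⇒m%n≡m (s≤s i≤m))

  position-toℕ : ∀ y → position (toℕ y) ≡ y
  position-toℕ y = toℕ-injective (toℕ-position (≤-pred (toℕ<n y)))

  adjacent : ∀ {i} → i < m → Adj (PathGraph (suc m)) (position i) (position (suc i))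
  adjacent i<m = inj₁ (trans (toℕ-position i<m) (cong suc (sym (toℕ-position (<⇒≤ i<m)))))

  open Trail (PathGraph (suc m)) position m adjacent

  short-walk : ∀ y z → ∃[ k ] k ≤ m × Walk (PathGraph (suc m)) y z k
  short-walk y z
    with k , k≤m , walk ← walk-within ≤-refl (λ _ _ → tt) z≤n (≤-pred (toℕ<n y)) z≤n (≤-pred (toℕ<n z)) =
    k , k≤m , subst₂ (λ a b → Walk _ a b k) (position-toℕ y) (position-toℕ z) walk

  connected : Connected (PathGraph (suc m))
  connected y z with k , _ , walk ← short-walk y z = k , walk

  diameter : ∀ {D} → IsDiam (PathGraph (suc m)) D → D ≡ m
  diameter ((y , z , _ , minimal) , maximal) with k , k≤m , walk ← short-walk y z =
    ≤-antisym (≤-trans (minimal k walk) k≤m) (maximal (position 0) (position m) m ends)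
    where
    ends : Dist (PathGraph (suc m)) (position 0) (position m) m
    ends = ascending z≤n ≤-refl (λ _ _ → tt) ,
           λ k walk → subst₂ _≤_ (toℕ-position ≤-refl) (cong (_+ k) (toℕ-position z≤n)) (path-walk-length walk)

m≤n/2⇒m+m≤n : ∀ {m n} → m ≤ n / 2 → m + m ≤ n
m≤n/2⇒m+m≤n {m} {n} m≤n/2 = begin
  m + m     ≡⟨ cong (m +_) (+-identityʳ m) ⟨
  2 * m     ≡⟨ *-comm 2 m ⟩
  m * 2     ≤⟨ *-monoˡ-≤ 2 m≤n/2 ⟩
  n / 2 * 2 ≤⟨ m/n*n≤m n 2 ⟩
  n         ∎
  where open ≤-Reasoning

Rg-cutset-of-diameter : ∀ {n} {G : Graph n} {D} → IsDiam G D → ∀ g → suc g ≤ D / 2 →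
                        Σ (Subset n) λ S → IsRgCutset G g S × ∣ S ∣ ≤ n ∸ D
Rg-cutset-of-diameter ((_ , _ , geodesic) , _) g g<D/2 = GeodesicCut.Rg-cutset geodesic g (m≤n/2⇒m+m≤n g<D/2)

κ-path : ∀ m {D} → IsDiam (PathGraph (suc m)) D → ∀ g → suc g ≤ D / 2 →
         IsKappa (PathGraph (suc m)) g 1 × suc m ∸ D ≡ 1
κ-path m {D} diam g g<D/2 with S , Rg , ∣S∣≤n∸D ← Rg-cutset-of-diameter diam g g<D/2 =
  ((S , Rg , ≤-antisym (subst (∣ S ∣ ≤_) order∸D≡1 ∣S∣≤n∸D) (nonempty Rg)) , λ _ → nonempty) , order∸D≡1
  where
  open PathGraphProperties m
  order∸D≡1 : suc m ∸ D ≡ 1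
  order∸D≡1 = subst (λ d → suc m ∸ d ≡ 1) (sym (diameter diam)) (m+n∸n≡m 1 m)
  nonempty : ∀ {S} → IsRgCutset (PathGraph (suc m)) g S → 1 ≤ ∣ S ∣
  nonempty (cut , _) = cutset-nonempty connected cut

proposition3p2 :
    ((n : ℕ) (G : Graph n) (D : ℕ) → Connected G → IsDiam G D →
      (g : ℕ) → suc g ≤ D / 2 →
      Σ (Subset n) λ S → IsRgCutset G g S × ∣ S ∣ ≤ n ∸ D)
    ×
    ((n : ℕ) → 3 ≤ n → (D : ℕ) → IsDiam (PathGraph n) D →
      (g : ℕ) → suc g ≤ D / 2 →
      IsKappa (PathGraph n) g 1 × n ∸ D ≡ 1)
proposition3p2 = (λ _ _ _ _ → Rg-cutset-of-diameter) , λ { (suc m) _ _ → κ-path m }
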